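{- Let $G$ be a graph. (1) The set $\{H \mid H\leq_R G,\ H\text{ is bunchy}\}$ has a unique $\leq_R$-maximal element $B=B(G)$. (2) If $H\leq_R G$ is bunchy and $\Phi\in\hom_R(G,H)$, then there exist $\Delta\in\hom_R(G,B)$ and $\Theta\in\hom_R(B,H)$ such that $\Phi=\Theta\circ\Delta$.
   Context: All graphs are finite directed graphs with state set $V(G)$, edge set $E(G)$, source/target maps $s,t$; loops and parallel edges allowed; all graphs sink-free. $E_I(G)=s^{ -1}(I)$, $F(I)=t(E_I(G))$. A homomorphism $\Phi:G\to H$ consists of maps on edges and ($\partial\Phi$) on states commuting with $s,t$. Graphs are identified up to isomorphism. A right-resolver is a surjective homomorphism such that $\Phi|_{E_I(G)}:E_I(G)\to E_{\partial\Phi(I)}(H)$ is bijective for all $I$; $\hom_R(G,H)$ is the set of these, $H\leq_R G$ if it is nonempty; $\leq_R$ is a partial order. $M(G)$ is the unique $\leq_R$-minimal graph with $M(G)\leq_R G$, and all right-resolvers $G\to M(G)$ share the state map $\Sigma_G:V(G)\to V(M(G))$. A state $I$ is bunchy if $\Sigma_G|_{F(I)}:F(I)\to F(\Sigma_G(I))$ is a bijection; $G$ is bunchy if all its states are bunchy. -}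

module Defs where

open import Data.Nat using (ℕ)
open import Data.Fin using (Fin)
open import Data.Product using (Σ; ∃; _×_; _,_)
open import Relation.Binary.PropositionalEquality using (_≡_)

record Graph : Set where
  field
    nV nE    : ℕ
    s t      : Fin nE → Fin nV
    sinkFree : ∀ (I : Fin nV) → ∃ λ (e : Fin nE) → s e ≡ I
open Graph public

V : Graph → Set
V G = Fin (nV G)

E : Graph → Set
E G = Fin (nE G)

_∈E_ : {G : Graph} → E G → V G → Set
_∈E_ {G} e I = s G e ≡ I

inF : (G : Graph) → V G → V G → Set
inF G I J = ∃ λ (e : E G) → (s G e ≡ I) × (t G e ≡ J)

Injective : {A B : Set} → (A → B) → Set
Injective f = ∀ x y → f x ≡ f y → x ≡ y

Surjective : {A B : Set} → (A → B) → Set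
Surjective {A} {B} f = ∀ (y : B) → ∃ λ (x : A) → f x ≡ y

record Hom (G H : Graph) : Set where
  field
    φ  : E G → E H
    ∂φ : V G → V H
    comm-s : ∀ e → s H (φ e) ≡ ∂φ (s G e)
    comm-t : ∀ e → t H (φ e) ≡ ∂φ (t G e)
open Hom public

_∘H_ : {G H K : Graph} → Hom H K → Hom G H → Hom G K
_∘H_ {G} {H} {K} Θ Δ = record
  { φ = λ e → φ Θ (φ Δ e)
  ; ∂φ = λ v → ∂φ Θ (∂φ Δ v)
  ; comm-s = λ e → trans' (comm-s Θ (φ Δ e)) (cong' (∂φ Θ) (comm-s Δ e))
  ; comm-t = λ e → trans' (comm-t Θ (φ Δ e)) (cong' (∂φ Θ) (comm-t Δ e))
  }
  where
  open import Relation.Binary.PropositionalEquality using () renaming (trans to trans'; cong to cong')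

_≈H_ : {G H : Graph} → Hom G H → Hom G H → Set
Φ ≈H Ψ = (∀ e → φ Φ e ≡ φ Ψ e) × (∀ v → ∂φ Φ v ≡ ∂φ Ψ v)

_≅_ : Graph → Graph → Set
G ≅ H = Σ (Hom G H) λ Φ →
  (Injective (φ Φ) × Surjective (φ Φ)) × (Injective (∂φ Φ) × Surjective (∂φ Φ))

record IsRightResolver {G H : Graph} (Φ : Hom G H) : Set where
  field
    surjE : Surjective (φ Φ)
    surjV : Surjective (∂φ Φ)
    localInj : ∀ (I : V G) (e₁ e₂ : E G) → s G e₁ ≡ I → s G e₂ ≡ I →
               φ Φ e₁ ≡ φ Φ e₂ → e₁ ≡ e₂
    localSurj : ∀ (I : V G) (e' : E H) → s H e' ≡ ∂φ Φ I →
                ∃ λ (e : E G) → (s G e ≡ I) × (φ Φ e ≡ e')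

HomR : Graph → Graph → Set
HomR G H = Σ (Hom G H) IsRightResolver

_≤R_ : Graph → Graph → Set
H ≤R G = HomR G H

IsMinimalBelow : Graph → Graph → Set
IsMinimalBelow M G = (M ≤R G) × (∀ (K : Graph) → K ≤R G → K ≤R M → K ≅ M)

BunchyState : (G : Graph) → V G → Set
BunchyState G I =
  ∀ (M : Graph) → IsMinimalBelow M G → (Ψ : HomR G M) →
  let Σ = ∂φ (Σ.proj₁ Ψ) in
    (∀ J → inF G I J → inF M (Σ I) (Σ J))
  × (∀ J₁ J₂ → inF G I J₁ → inF G I J₂ → Σ J₁ ≡ Σ J₂ → J₁ ≡ J₂)
  × (∀ K → inF M (Σ I) K → ∃ λ J → inF G I J × (Σ J ≡ K))
  where import Data.Product as Σ

Bunchy : Graph → Set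
Bunchy G = ∀ (I : V G) → BunchyState G I

InBunchySet : Graph → Graph → Set
InBunchySet G H = (H ≤R G) × Bunchy H

IsMaximalBunchy : Graph → Graph → Set
IsMaximalBunchy G B = InBunchySet G B × (∀ (H : Graph) → InBunchySet G H → B ≤R H → H ≅ B)

-- Let ≈ be the coarsest equitable equivalence on the states of G: related states have equally many
-- out-edges into every ≈-class. It is reached by iterated refinement, it contains the state kernel of
-- every right-resolver out of G (lifting along the resolver injects out-edges into out-edges), and G/≈ is
-- M(G). Let ∼ be the least equivalence such that I ∼ I′, I → J, I′ → J′ and J ≈ J′ force J ∼ J′. For a
-- right-resolver Φ whose state kernel contains ∼, lifting along Φ matches the out-edges of a state with
-- those of its ∼-representative, so B = G/∼ is a right-resolver image of G through which Φ factors.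
-- B is bunchy because ∼ identifies any two followers of a state with the same image in M(G). Conversely,
-- if H is bunchy, the state kernel of any right-resolver G → H is closed under the rule defining ∼, so it
-- contains ∼ and Φ factors through B. Since right-resolvers in both directions between finite graphs are
-- isomorphisms, this makes B maximal and unique.

module Submission where

open import Defs
open import Data.Bool using (Bool; true; false; T; not)
open import Data.Bool.Properties using (not-injective) renaming (_≟_ to _≟ᵇ_)
open import Data.Empty using (⊥-elim)
open import Data.Fin using (Fin; zero; suc; cast)
open import Data.Fin.Properties
  using (suc-injective; injective⇒≤; <⇒notInjective; any?; all?; ¬∀⟶∃¬; cast-involutive)
  renaming (_≟_ to _≟ᶠ_)
open import Data.Maybe using (Maybe; just; nothing; fromMaybe)
open import Data.Nat using (ℕ; zero; suc; _+_; _≤_; _<_; z≤n; s≤s) renaming (_≟_ to _≟ⁿ_)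
open import Data.Nat.Induction using (<-wellFounded)
open import Data.Nat.Properties using (≤-antisym; +-mono-≤; +-mono-<-≤; +-mono-≤-<)
open import Data.Product using (Σ; ∃; ∃₂; _×_; _,_; proj₁; proj₂)
open import Data.Sum using (inj₁; inj₂)
open import Function using (_∘_; id)
open import Function.Bundles using (mk⇔)
open import Induction.WellFounded using (Acc; acc)
open import Level using (0ℓ)
open import Relation.Binary.Construct.Closure.ReflexiveTransitive using (Star; ε; _◅_; fold)
open import Relation.Binary.PropositionalEquality
  using (_≡_; _≢_; refl; sym; trans; cong; subst; module ≡-Reasoning)
open import Relation.Nullary using (¬_; Dec; yes; no)
open import Relation.Nullary.Decidable using (⌊_⌋; T?; _×-dec_; _⊎-dec_; map′; toWitness; fromWitness; does-⇔)
open import Relation.Binary.Core using (Rel; _⇒_)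
open import Relation.Binary.Definitions using (Transitive)
open import Relation.Binary.Structures using (IsEquivalence)

count : ∀ {n} → (Fin n → Bool) → ℕ
count {zero}  p = 0
count {suc n} p with p zero
... | true  = suc (count (p ∘ suc))
... | false = count (p ∘ suc)

enum : ∀ {n} (p : Fin n → Bool) → Fin (count p) → Fin n
enum {suc n} p i with p zero
enum {suc n} p zero    | true  = zero
enum {suc n} p (suc i) | true  = suc (enum (p ∘ suc) i)
enum {suc n} p i       | false = suc (enum (p ∘ suc) i)

index : ∀ {n} (p : Fin n → Bool) (x : Fin n) → .(T (p x)) → Fin (count p)
index {suc n} p zero px with p zero
... | true = zero
index {suc n} p (suc x) px with p zero
... | true  = suc (index (p ∘ suc) x px)
... | false = index (p ∘ suc) x px

enum-sound : ∀ {n} (p : Fin n → Bool) i → T (p (enum p i))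
enum-sound {suc n} p i with p zero in eq
enum-sound {suc n} p zero    | true  = subst T (sym eq) _
enum-sound {suc n} p (suc i) | true  = enum-sound (p ∘ suc) i
enum-sound {suc n} p i       | false = enum-sound (p ∘ suc) i

enum-index : ∀ {n} (p : Fin n → Bool) x .(px : T (p x)) → enum p (index p x px) ≡ x
enum-index {suc n} p zero px with p zero
... | true = refl
enum-index {suc n} p (suc x) px with p zero
... | true  = cong suc (enum-index (p ∘ suc) x px)
... | false = cong suc (enum-index (p ∘ suc) x px)

enum-injective : ∀ {n} (p : Fin n → Bool) {i j} → enum p i ≡ enum p j → i ≡ j
enum-injective {suc n} p {i} {j} eq with p zero
enum-injective {suc n} p {zero}  {zero}  eq | true  = refl
enum-injective {suc n} p {suc i} {suc j} eq | true  = cong suc (enum-injective (p ∘ suc) (suc-injective eq))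
enum-injective {suc n} p {i}     {j}     eq | false = enum-injective (p ∘ suc) (suc-injective eq)

index-enum : ∀ {n} (p : Fin n → Bool) i .(pi : T (p (enum p i))) → index p (enum p i) pi ≡ i
index-enum p i pi = enum-injective p (enum-index p (enum p i) pi)

index-injective : ∀ {n} (p : Fin n → Bool) {x y} .{px : T (p x)} .{py : T (p y)} →
                  index p x px ≡ index p y py → x ≡ y
index-injective p {x} {y} {px} {py} eq =
  trans (sym (enum-index p x px)) (trans (cong (enum p) eq) (enum-index p y py))

count-≤-injection : ∀ {m n} {p : Fin m → Bool} {q : Fin n → Bool} (f : ∀ x → T (p x) → Fin n) →
                    (∀ x px → T (q (f x px))) → (∀ {x y} px py → f x px ≡ f y py → x ≡ y) → count p ≤ count q
count-≤-injection {p = p} {q} f f-sound f-injective =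
  injective⇒≤ {f = g} (λ eq → enum-injective p (f-injective _ _ (index-injective q eq)))
  where
  g : Fin (count p) → Fin (count q)
  g i = index q (f (enum p i) (enum-sound p i)) (f-sound _ _)

module _ {n} {p q : Fin n → Bool} (p⊆q : ∀ {x} → T (p x) → T (q x)) where

  private
    embed : Fin (count p) → Fin (count q)
    embed i = index q (enum p i) (p⊆q (enum-sound p i))

    embed-injective : ∀ {i j} → embed i ≡ embed j → i ≡ j
    embed-injective = enum-injective p ∘ index-injective q

  count-mono : count p ≤ count q
  count-mono = injective⇒≤ embed-injective

  count-mono-< : ∀ {y} → ¬ T (p y) → T (q y) → count p < count q
  count-mono-< {y} ¬py qy = injective⇒≤ embed′-injective
    where
    embed′ : Fin (suc (count p)) → Fin (count q)
    embed′ zero    = index q y qy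
    embed′ (suc i) = embed i

    y∉image : ∀ i → index q y qy ≢ embed i
    y∉image i eq = ¬py (subst (T ∘ p) (sym (index-injective q eq)) (enum-sound p i))

    embed′-injective : ∀ {i j} → embed′ i ≡ embed′ j → i ≡ j
    embed′-injective {zero}  {zero}  _  = refl
    embed′-injective {zero}  {suc j} eq = ⊥-elim (y∉image j eq)
    embed′-injective {suc i} {zero}  eq = ⊥-elim (y∉image i (sym eq))
    embed′-injective {suc i} {suc j} eq = cong suc (embed-injective eq)

module _ {m n} (p : Fin m → Bool) (q : Fin n → Bool) .(same : count p ≡ count q) where

  rematch : (x : Fin m) → .(T (p x)) → Fin n
  rematch x px = enum q (cast same (index p x px))

  rematch-sound : ∀ x .(px : T (p x)) → T (q (rematch x px))
  rematch-sound x px = enum-sound q _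

  rematch-injective : ∀ {x y} .{px : T (p x)} .{py : T (p y)} → rematch x px ≡ rematch y py → x ≡ y
  rematch-injective {x} {y} eq = index-injective p (begin
    index p x _                                ≡⟨ cast-involutive (sym same) same _ ⟨
    cast (sym same) (cast same (index p x _))  ≡⟨ cong (cast (sym same)) (enum-injective q eq) ⟩
    cast (sym same) (cast same (index p y _))  ≡⟨ cast-involutive (sym same) same _ ⟩
    index p y _                                ∎)
    where open ≡-Reasoning

  rematch-onto : ∀ y → T (q y) → ∃ λ x → Σ (T (p x)) λ px → rematch x px ≡ y
  rematch-onto y qy = x , enum-sound p i , (begin
    enum q (cast same (index p x _))   ≡⟨ cong (enum q ∘ cast same) (index-enum p i _) ⟩
    enum q (cast same i)               ≡⟨ cong (enum q) (cast-involutive same (sym same) _) ⟩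
    enum q (index q y qy)              ≡⟨ enum-index q y qy ⟩
    y                                  ∎)
    where
    open ≡-Reasoning
    i = cast (sym same) (index q y qy)
    x = enum p i

first : ∀ {n} → (Fin n → Bool) → Maybe (Fin n)
first {zero}  p = nothing
first {suc n} p with p zero
... | true  = just zero
... | false = Data.Maybe.map suc (first (p ∘ suc))

first-sound : ∀ {n} (p : Fin n → Bool) {y} → first p ≡ just y → T (p y)
first-sound {suc n} p eq with p zero in p0
first-sound {suc n} p refl | true = subst T (sym p0) _
first-sound {suc n} p eq   | false with first (p ∘ suc) in eq′
first-sound {suc n} p refl | false | just y = first-sound (p ∘ suc) eq′

first-complete : ∀ {n} (p : Fin n → Bool) {x} → T (p x) → ∃ λ y → first p ≡ just y
first-complete {suc n} p {x} px with p zero in p0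
... | true = zero , refl
first-complete {suc n} p {zero}  px | false = ⊥-elim (subst T p0 px)
first-complete {suc n} p {suc x} px | false with first-complete (p ∘ suc) px
... | y , eq rewrite eq = suc y , refl

first-cong : ∀ {n} {p q : Fin n → Bool} → (∀ x → p x ≡ q x) → first p ≡ first q
first-cong {zero}          p≗q = refl
first-cong {suc n} {p} {q} p≗q with p zero | q zero | p≗q zero
... | true  | true  | refl = refl
... | false | false | refl = cong (Data.Maybe.map suc) (first-cong (p≗q ∘ suc))

∑ : ∀ {n} → (Fin n → ℕ) → ℕ
∑ {zero}  f = 0
∑ {suc n} f = f zero + ∑ (f ∘ suc)

∑-mono-≤ : ∀ {n} {f g : Fin n → ℕ} → (∀ x → f x ≤ g x) → ∑ f ≤ ∑ g
∑-mono-≤ {zero}  f≤g = z≤n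
∑-mono-≤ {suc n} f≤g = +-mono-≤ (f≤g zero) (∑-mono-≤ (f≤g ∘ suc))

∑-mono-< : ∀ {n} {f g : Fin n → ℕ} → (∀ x → f x ≤ g x) → ∀ y → f y < g y → ∑ f < ∑ g
∑-mono-< {suc n} f≤g zero    fy<gy = +-mono-<-≤ fy<gy (∑-mono-≤ (f≤g ∘ suc))
∑-mono-< {suc n} f≤g (suc y) fy<gy = +-mono-≤-< (f≤g zero) (∑-mono-< (f≤g ∘ suc) y fy<gy)

-- Relations are Boolean-valued so that the fixed points below can be computed.
BRel : ℕ → Set
BRel n = Fin n → Fin n → Bool

⟦_⟧ : ∀ {n} → BRel n → Rel (Fin n) 0ℓ
⟦ R ⟧ x y = T (R x y)

_⊆ᵇ_ : ∀ {n} → BRel n → BRel n → Set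
R ⊆ᵇ S = ⟦ R ⟧ ⇒ ⟦ S ⟧

_≐_ : ∀ {n} → BRel n → BRel n → Set
R ≐ S = ∀ x y → R x y ≡ S x y

_≐?_ : ∀ {n} (R S : BRel n) → Dec (R ≐ S)
R ≐? S = all? λ x → all? λ y → R x y ≟ᵇ S x y

complement : ∀ {n} → BRel n → BRel n
complement R x y = not (R x y)

size : ∀ {n} → BRel n → ℕ
size R = ∑ (count ∘ R)

≢-witness : ∀ {n} {R S : BRel n} → ¬ R ≐ S → ∃₂ λ x y → R x y ≢ S x y
≢-witness {n} {R} {S} R≉S with x , ¬∀y ← ¬∀⟶∃¬ n _ (λ x → all? λ y → R x y ≟ᵇ S x y) R≉S
                            with y , Rxy≢Sxy ← ¬∀⟶∃¬ n _ (λ y → R x y ≟ᵇ S x y) ¬∀y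
  = x , y , Rxy≢Sxy

strictly-below : ∀ {a b} → (T a → T b) → a ≢ b → ¬ T a × T b
strictly-below {false} {true}  _   _   = (λ ()) , _
strictly-below {false} {false} _   a≢b = ⊥-elim (a≢b refl)
strictly-below {true}  {true}  _   a≢b = ⊥-elim (a≢b refl)
strictly-below {true}  {false} a⇒b _   = ⊥-elim (a⇒b _)

size-mono-< : ∀ {n} {R S : BRel n} → R ⊆ᵇ S → ¬ R ≐ S → size R < size S
size-mono-< R⊆S R≉S with x , y , Rxy≢Sxy ← ≢-witness R≉S
                    with ¬Rxy , Sxy ← strictly-below (R⊆S {x} {y}) Rxy≢Sxy
  = ∑-mono-< (λ z → count-mono (λ {y} → R⊆S {z} {y})) x
             (count-mono-< (λ {y} → R⊆S {x} {y}) ¬Rxy Sxy)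

not-antitone : ∀ {a b} → (T a → T b) → T (not b) → T (not a)
not-antitone {false}         _   _ = _
not-antitone {true}  {false} a⇒b _ = a⇒b _

complement-antitone : ∀ {n} {R S : BRel n} → R ⊆ᵇ S → complement S ⊆ᵇ complement R
complement-antitone R⊆S = not-antitone R⊆S

complement-injective : ∀ {n} {R S : BRel n} → complement R ≐ complement S → R ≐ S
complement-injective R̄≐S̄ x y = not-injective (R̄≐S̄ x y)

module _ {A : Set} (F : A → A) where

  Iterates : A → A → Set
  Iterates = Star (λ x y → F x ≡ y)

  Iterates-preserves : (P : A → Set) → (∀ {x} → P x → P (F x)) → ∀ {x y} → Iterates x y → P x → P y
  Iterates-preserves P P-step = fold (λ x y → P x → P y) (λ { refl P⇒ → P⇒ ∘ P-step }) id

  fixpoint-by-measure : (_≈_ : A → A → Set) (μ : A → ℕ) → (∀ x → Dec (F x ≈ x)) →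
                        (∀ x → ¬ F x ≈ x → μ (F x) < μ x) → ∀ x → ∃ λ y → Iterates x y × F y ≈ y
  fixpoint-by-measure _≈_ μ stable? μ-decreases x = go x (<-wellFounded (μ x))
    where
    go : ∀ x → Acc _<_ (μ x) → ∃ λ y → Iterates x y × F y ≈ y
    go x (acc rec) with stable? x
    ... | yes Fx≈x = x , ε , Fx≈x
    ... | no  Fx≉x with y , x↠y , Fy≈y ← go (F x) (rec (μ-decreases x Fx≉x)) = y , refl ◅ x↠y , Fy≈y

module _ {n} (F : BRel n → BRel n) where

  deflationary-fixpoint : (∀ R → F R ⊆ᵇ R) → ∀ R → ∃ λ S → Iterates F R S × F S ≐ S
  deflationary-fixpoint F⊆ = fixpoint-by-measure F _≐_ size (λ R → F R ≐? R)
    (λ R → size-mono-< (λ {x} {y} → F⊆ R {x} {y}))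

  inflationary-fixpoint : (∀ R → R ⊆ᵇ F R) → ∀ R → ∃ λ S → Iterates F R S × F S ≐ S
  inflationary-fixpoint ⊆F = fixpoint-by-measure F _≐_ (size ∘ complement) (λ R → F R ≐? R)
    (λ R FR≉R → size-mono-< (complement-antitone (λ {x} {y} → ⊆F R {x} {y})) (FR≉R ∘ complement-injective))

module _ {a b} {f : Fin a → Fin b} (f-onto : Surjective f) where

  private
    section : Fin b → Fin a
    section y = proj₁ (f-onto y)

    f∘section : ∀ y → f (section y) ≡ y
    f∘section y = proj₂ (f-onto y)

    section-injective : ∀ {y y′} → section y ≡ section y′ → y ≡ y′
    section-injective {y} {y′} eq = trans (sym (f∘section y)) (trans (cong f eq) (f∘section y′))

    -- If x were not in the image, extending `section` by x would inject Fin (suc b) into Fin a.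
    section-onto : a ≤ b → ∀ x → ∃ λ y → section y ≡ x
    section-onto a≤b x with any? (λ y → section y ≟ᶠ x)
    ... | yes found = found
    ... | no  x∉im  = ⊥-elim (<⇒notInjective (s≤s a≤b) extended-injective)
      where
      extended : Fin (suc b) → Fin a
      extended zero    = x
      extended (suc y) = section y

      extended-injective : ∀ {y y′} → extended y ≡ extended y′ → y ≡ y′
      extended-injective {zero}  {zero}   _  = refl
      extended-injective {zero}  {suc y′} eq = ⊥-elim (x∉im (y′ , sym eq))
      extended-injective {suc y} {zero}   eq = ⊥-elim (x∉im (y , eq))
      extended-injective {suc y} {suc y′} eq = cong suc (section-injective eq)

  surjective⇒≥ : b ≤ a
  surjective⇒≥ = injective⇒≤ section-injective

  surjective⇒injective : a ≤ b → Injective f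
  surjective⇒injective a≤b x x′ fx≡fx′ = begin
    x                 ≡⟨ section∘f x ⟨
    section (f x)     ≡⟨ cong section fx≡fx′ ⟩
    section (f x′)    ≡⟨ section∘f x′ ⟩
    x′                ∎
    where
    open ≡-Reasoning
    section∘f : ∀ x → section (f x) ≡ x
    section∘f x with y , refl ← section-onto a≤b x = cong section (f∘section y)

mkHomR : ∀ {G H} (Φ : Hom G H) → Surjective (∂φ Φ) →
         (∀ I e₁ e₂ → s G e₁ ≡ I → s G e₂ ≡ I → φ Φ e₁ ≡ φ Φ e₂ → e₁ ≡ e₂) →
         (∀ I e′ → s H e′ ≡ ∂φ Φ I → ∃ λ e → s G e ≡ I × φ Φ e ≡ e′) →
         HomR G H
mkHomR {G} {H} Φ onto inj lift = Φ , record
  { surjE     = λ e′ → let I , ΦI≡ = onto (s H e′); e , _ , Φe≡e′ = lift I e′ (sym ΦI≡) in e , Φe≡e′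
  ; surjV     = onto
  ; localInj  = inj
  ; localSurj = lift
  }

_∘R_ : ∀ {G H K} → HomR H K → HomR G H → HomR G K
_∘R_ {G} {H} {K} (Θ , Θ-rr) (Δ , Δ-rr) = mkHomR (Θ ∘H Δ) onto inj lift
  where
  module Θ = IsRightResolver Θ-rr
  module Δ = IsRightResolver Δ-rr

  onto : Surjective (∂φ (Θ ∘H Δ))
  onto k with h , refl ← Θ.surjV k with I , refl ← Δ.surjV h = I , refl

  inj : ∀ I e₁ e₂ → s G e₁ ≡ I → s G e₂ ≡ I → φ Θ (φ Δ e₁) ≡ φ Θ (φ Δ e₂) → e₁ ≡ e₂
  inj I e₁ e₂ s₁ s₂ eq = Δ.localInj I e₁ e₂ s₁ s₂
    (Θ.localInj (∂φ Δ I) (φ Δ e₁) (φ Δ e₂) (trans (comm-s Δ e₁) (cong (∂φ Δ) s₁))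
                                          (trans (comm-s Δ e₂) (cong (∂φ Δ) s₂)) eq)

  lift : ∀ I e″ → s K e″ ≡ ∂φ Θ (∂φ Δ I) → ∃ λ e → s G e ≡ I × φ Θ (φ Δ e) ≡ e″
  lift I e″ eq with e′ , s≡ , refl ← Θ.localSurj (∂φ Δ I) e″ eq
               with e , s≡′ , refl ← Δ.localSurj I e′ s≡ = e , s≡′ , refl

≅-sym : ∀ {A B} → A ≅ B → B ≅ A
≅-sym {A} {B} (Φ , (φ-inj , φ-onto) , (∂φ-inj , ∂φ-onto)) = Ψ , (ψ-inj , ψ-onto) , (∂ψ-inj , ∂ψ-onto)
  where
  ψ : E B → E A
  ψ e = proj₁ (φ-onto e)

  ∂ψ : V B → V A
  ∂ψ I = proj₁ (∂φ-onto I)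

  φ∘ψ : ∀ e → φ Φ (ψ e) ≡ e
  φ∘ψ e = proj₂ (φ-onto e)

  ∂φ∘∂ψ : ∀ I → ∂φ Φ (∂ψ I) ≡ I
  ∂φ∘∂ψ I = proj₂ (∂φ-onto I)

  Ψ : Hom B A
  Ψ = record
    { φ = ψ ; ∂φ = ∂ψ
    ; comm-s = λ e → ∂φ-inj _ _ (trans (sym (comm-s Φ (ψ e))) (trans (cong (s B) (φ∘ψ e)) (sym (∂φ∘∂ψ (s B e)))))
    ; comm-t = λ e → ∂φ-inj _ _ (trans (sym (comm-t Φ (ψ e))) (trans (cong (t B) (φ∘ψ e)) (sym (∂φ∘∂ψ (t B e)))))
    }

  ψ-inj : Injective ψ
  ψ-inj e e′ eq = trans (sym (φ∘ψ e)) (trans (cong (φ Φ) eq) (φ∘ψ e′))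

  ψ-onto : Surjective ψ
  ψ-onto e = φ Φ e , φ-inj _ _ (φ∘ψ (φ Φ e))

  ∂ψ-inj : Injective ∂ψ
  ∂ψ-inj I J eq = trans (sym (∂φ∘∂ψ I)) (trans (cong (∂φ Φ) eq) (∂φ∘∂ψ J))

  ∂ψ-onto : Surjective ∂ψ
  ∂ψ-onto I = ∂φ Φ I , ∂φ-inj _ _ (∂φ∘∂ψ (∂φ Φ I))

HomR-antisym : ∀ {A B} → HomR A B → HomR B A → A ≅ B
HomR-antisym (Φ , Φ-rr) (Ψ , Ψ-rr) =
  Φ , (surjective⇒injective Φ.surjE (surjective⇒≥ Ψ.surjE) , Φ.surjE)
    , (surjective⇒injective Φ.surjV (surjective⇒≥ Ψ.surjV) , Φ.surjV)
  where
  module Φ = IsRightResolver Φ-rr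
  module Ψ = IsRightResolver Ψ-rr

Ker : ∀ {G H} → HomR G H → V G → V G → Set
Ker (Φ , _) x y = ∂φ Φ x ≡ ∂φ Φ y

descend : ∀ {G H K} (Φ : HomR G H) (Ψ : HomR G K) → (Ker Φ ⇒ Ker Ψ) →
          Σ (HomR H K) λ Θ → ∀ x → ∂φ (proj₁ Θ) (∂φ (proj₁ Φ) x) ≡ ∂φ (proj₁ Ψ) x
descend {G} {H} {K} (Φ , Φ-rr) (Ψ , Ψ-rr) Ker⊆ = mkHomR Θ onto inj lift′ , ∂Θ∘∂Φ
  where
  module Φ = IsRightResolver Φ-rr
  module Ψ = IsRightResolver Ψ-rr

  pick : V H → V G
  pick h = proj₁ (Φ.surjV h)

  ∂Φ∘pick : ∀ h → ∂φ Φ (pick h) ≡ h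
  ∂Φ∘pick h = proj₂ (Φ.surjV h)

  lift : (e′ : E H) → ∃ λ e → s G e ≡ pick (s H e′) × φ Φ e ≡ e′
  lift e′ = Φ.localSurj (pick (s H e′)) e′ (sym (∂Φ∘pick _))

  ∂Θ∘∂Φ : ∀ x → ∂φ Ψ (pick (∂φ Φ x)) ≡ ∂φ Ψ x
  ∂Θ∘∂Φ x = Ker⊆ (∂Φ∘pick (∂φ Φ x))

  Θ : Hom H K
  Θ = record
    { φ = λ e′ → φ Ψ (proj₁ (lift e′))
    ; ∂φ = λ h → ∂φ Ψ (pick h)
    ; comm-s = λ e′ → let e , s≡ , _ = lift e′ in trans (comm-s Ψ e) (cong (∂φ Ψ) s≡)
    ; comm-t = λ e′ → let e , _ , Φe≡e′ = lift e′ in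
        trans (comm-t Ψ e) (sym (trans (cong (∂φ Ψ ∘ pick) (trans (cong (t H) (sym Φe≡e′)) (comm-t Φ e)))
                                       (∂Θ∘∂Φ (t G e))))
    }

  onto : Surjective (∂φ Θ)
  onto k = let x , ∂Ψx≡k = Ψ.surjV k in ∂φ Φ x , trans (∂Θ∘∂Φ x) ∂Ψx≡k

  inj : ∀ h e₁′ e₂′ → s H e₁′ ≡ h → s H e₂′ ≡ h → φ Θ e₁′ ≡ φ Θ e₂′ → e₁′ ≡ e₂′
  inj h e₁′ e₂′ refl s₂ eq with e₁ , s₁≡ , refl ← lift e₁′ | e₂ , s₂≡ , refl ← lift e₂′ =
    cong (φ Φ) (Ψ.localInj (pick h) e₁ e₂ s₁≡ (trans s₂≡ (cong pick s₂)) eq)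

  lift′ : ∀ h e″ → s K e″ ≡ ∂φ Θ h → ∃ λ e′ → s H e′ ≡ h × φ Θ e′ ≡ e″
  lift′ h e″ eq with e , s≡ , refl ← Ψ.localSurj (pick h) e″ eq = φ Φ e , s≡′ , cong (φ Ψ) lift-Φe≡e
    where
    s≡′ : s H (φ Φ e) ≡ h
    s≡′ = trans (comm-s Φ e) (trans (cong (∂φ Φ) s≡) (∂Φ∘pick h))
    lift-Φe≡e : proj₁ (lift (φ Φ e)) ≡ e
    lift-Φe≡e = let e₁ , s₁≡ , Φe₁≡ = lift (φ Φ e) in
      Φ.localInj (pick h) e₁ e (trans s₁≡ (cong pick s≡′)) s≡ Φe₁≡

edgesInto : (G : Graph) → BRel (nV G) → V G → V G → E G → Bool
edgesInto G R I J e = ⌊ (s G e ≟ᶠ I) ×-dec T? (R (t G e) J) ⌋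

Equitable : (G : Graph) → BRel (nV G) → Set
Equitable G R = ∀ {I I′} → T (R I I′) → ∀ J → count (edgesInto G R I J) ≡ count (edgesInto G R I′ J)

inF? : (G : Graph) → ∀ I J → Dec (inF G I J)
inF? G I J = any? λ e → (s G e ≟ᶠ I) ×-dec (t G e ≟ᶠ J)

-- Lifting along Φ at y injects the edges leaving x into a given R-class into those leaving y.
Ker⇒count-≤ : ∀ {G H} (Φ : HomR G H) {R : BRel (nV G)} → Ker Φ ⇒ ⟦ R ⟧ → Transitive ⟦ R ⟧ →
              ∀ {x y} → Ker Φ x y → ∀ J → count (edgesInto G R x J) ≤ count (edgesInto G R y J)
Ker⇒count-≤ {G} {H} (Φ , Φ-rr) {R} Ker⊆R R-trans {x} {y} x≈y J =
  count-≤-injection lift lift-sound lift-injective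
  where
  module Φ = IsRightResolver Φ-rr

  lift′ : ∀ e → T (edgesInto G R x J e) → ∃ λ e′ → s G e′ ≡ y × φ Φ e′ ≡ φ Φ e
  lift′ e p = let s≡x , _ = toWitness p in
    Φ.localSurj y (φ Φ e) (trans (comm-s Φ e) (trans (cong (∂φ Φ) s≡x) x≈y))

  lift : ∀ e → T (edgesInto G R x J e) → E G
  lift e p = proj₁ (lift′ e p)

  lift-sound : ∀ e p → T (edgesInto G R y J (lift e p))
  lift-sound e p with _ , t∼J ← toWitness p | e′ , s≡y , φ≡ ← lift′ e p =
    fromWitness (s≡y , R-trans (Ker⊆R (trans (sym (comm-t Φ e′)) (trans (cong (t H) φ≡) (comm-t Φ e)))) t∼J)

  lift-injective : ∀ {e₁ e₂} p₁ p₂ → lift e₁ p₁ ≡ lift e₂ p₂ → e₁ ≡ e₂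
  lift-injective {e₁} {e₂} p₁ p₂ eq = Φ.localInj x e₁ e₂ (proj₁ (toWitness p₁)) (proj₁ (toWitness p₂))
    (trans (sym (proj₂ (proj₂ (lift′ e₁ p₁)))) (trans (cong (φ Φ) eq) (proj₂ (proj₂ (lift′ e₂ p₂)))))

inF-map : ∀ {G H} (Φ : Hom G H) {I J} → inF G I J → inF H (∂φ Φ I) (∂φ Φ J)
inF-map Φ (e , refl , refl) = φ Φ e , comm-s Φ e , comm-t Φ e

inF-lift : ∀ {G H} (Φ : HomR G H) {I K} → inF H (∂φ (proj₁ Φ) I) K → ∃ λ J → inF G I J × ∂φ (proj₁ Φ) J ≡ K
inF-lift {G} {H} (Φ , Φ-rr) {I} (e′ , s≡ , refl) with e , s≡I , refl ← IsRightResolver.localSurj Φ-rr I e′ s≡ =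
  t G e , (e , s≡I , refl) , sym (comm-t Φ e)

-- The other two clauses of bunchiness hold for every right-resolver.
bunchy-if-followers-separated : ∀ {K} X →
  (∀ {M} (Ψ : HomR K M) {J₁ J₂} → inF K X J₁ → inF K X J₂ → ∂φ (proj₁ Ψ) J₁ ≡ ∂φ (proj₁ Ψ) J₂ → J₁ ≡ J₂) →
  BunchyState K X
bunchy-if-followers-separated X separated M _ Ψ =
  (λ _ → inF-map (proj₁ Ψ)) , (λ _ _ → separated Ψ) , (λ _ → inF-lift Ψ)

module Quotient (G : Graph) (R : BRel (nV G)) (R-equiv : IsEquivalence ⟦ R ⟧) where

  open IsEquivalence R-equiv renaming (refl to ∼-refl; sym to ∼-sym; trans to ∼-trans)

  infix 4 _∼_
  _∼_ : Rel (V G) 0ℓ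
  _∼_ = ⟦ R ⟧

  rep : V G → V G
  rep x = fromMaybe x (first (λ y → R y x))

  rep-∼ : ∀ x → rep x ∼ x
  rep-∼ x with y , eq ← first-complete (λ y → R y x) (∼-refl {x}) rewrite eq = first-sound _ eq

  ∼⇒same-class : ∀ {x y} → x ∼ y → ∀ z → R z x ≡ R z y
  ∼⇒same-class x∼y z = does-⇔ (mk⇔ (λ z∼x → ∼-trans z∼x x∼y) (λ z∼y → ∼-trans z∼y (∼-sym x∼y))) (T? _) (T? _)

  rep-cong : ∀ {x y} → x ∼ y → rep x ≡ rep y
  rep-cong {x} {y} x∼y with w , eq ← first-complete (λ z → R z y) (∼-refl {y}) =
    trans (cong (fromMaybe x) (trans (first-cong (∼⇒same-class x∼y)) eq)) (sym (cong (fromMaybe y) eq))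

  rep-idem : ∀ x → rep (rep x) ≡ rep x
  rep-idem x = rep-cong (rep-∼ x)

  rep≡⇒∼ : ∀ {x y} → rep x ≡ rep y → x ∼ y
  rep≡⇒∼ {x} {y} eq = ∼-trans (∼-sym (rep-∼ x)) (subst (_∼ y) (sym eq) (rep-∼ y))

  -- The states of the quotient are the representatives, the edges those of G leaving a representative.
  isRep : V G → Bool
  isRep x = ⌊ rep x ≟ᶠ x ⌋

  leavesRep : E G → Bool
  leavesRep e = isRep (s G e)

  [_] : V G → Fin (count isRep)
  [ x ] = index isRep (rep x) (fromWitness (rep-idem x))

  repOf : Fin (count isRep) → V G
  repOf = enum isRep

  edgeOf : Fin (count leavesRep) → E G
  edgeOf = enum leavesRep

  edgeIndex : (e : E G) → .(rep (s G e) ≡ s G e) → Fin (count leavesRep)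
  edgeIndex e leaves = index leavesRep e (fromWitness leaves)

  repOf-[] : ∀ x → repOf [ x ] ≡ rep x
  repOf-[] x = enum-index isRep (rep x) _

  rep-repOf : ∀ X → rep (repOf X) ≡ repOf X
  rep-repOf X = toWitness (enum-sound isRep X)

  []-repOf : ∀ X → [ repOf X ] ≡ X
  []-repOf X = enum-injective isRep (trans (repOf-[] (repOf X)) (rep-repOf X))

  []-cong : ∀ {x y} → x ∼ y → [ x ] ≡ [ y ]
  []-cong {x} {y} x∼y = enum-injective isRep (trans (repOf-[] x) (trans (rep-cong x∼y) (sym (repOf-[] y))))

  []≡⇒∼ : ∀ {x y} → [ x ] ≡ [ y ] → x ∼ y
  []≡⇒∼ {x} {y} eq = rep≡⇒∼ (trans (sym (repOf-[] x)) (trans (cong repOf eq) (repOf-[] y)))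

  edgeOf-edgeIndex : ∀ e .(leaves : rep (s G e) ≡ s G e) → edgeOf (edgeIndex e leaves) ≡ e
  edgeOf-edgeIndex e leaves = enum-index leavesRep e _

  s-edgeOf : ∀ i → s G (edgeOf i) ≡ repOf [ s G (edgeOf i) ]
  s-edgeOf i = sym (trans (repOf-[] _) (toWitness (enum-sound leavesRep i)))

  leaves-repOf : ∀ {e} X → s G e ≡ repOf X → rep (s G e) ≡ s G e
  leaves-repOf X s≡ = trans (cong rep s≡) (trans (rep-repOf X) (sym s≡))

  quotient : Graph
  quotient = record
    { nV = count isRep
    ; nE = count leavesRep
    ; s = [_] ∘ s G ∘ edgeOf
    ; t = [_] ∘ t G ∘ edgeOf
    ; sinkFree = λ X → let e , s≡ = sinkFree G (repOf X); leaves = leaves-repOf X s≡ in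
        edgeIndex e leaves ,
        trans (cong ([_] ∘ s G) (edgeOf-edgeIndex e leaves)) (trans (cong [_] s≡) ([]-repOf X))
    }

  -- For every state I, move restricts to a bijection from the out-edges of I onto those of rep I, which
  -- are the out-edges of [ I ] in the quotient; the class of the target is kept.
  record Transport : Set where
    field
      move           : E G → E G
      move-source    : ∀ e → s G (move e) ≡ rep (s G e)
      move-target    : ∀ e → t G (move e) ∼ t G e
      move-injective : ∀ {e₁ e₂} → s G e₁ ≡ s G e₂ → move e₁ ≡ move e₂ → e₁ ≡ e₂
      move-onto      : ∀ I e₀ → s G e₀ ≡ rep I → ∃ λ e → s G e ≡ I × move e ≡ e₀

  move-leavesRep : (τ : Transport) → ∀ e → rep (s G (Transport.move τ e)) ≡ s G (Transport.move τ e)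
  move-leavesRep τ e = trans (cong rep (move-source e)) (trans (rep-idem _) (sym (move-source e)))
    where open Transport τ

  quotientMap : Transport → HomR G quotient
  quotientMap τ = mkHomR Δ (λ X → repOf X , []-repOf X) inj lift
    where
    open Transport τ
    leaves = move-leavesRep τ

    Δ : Hom G quotient
    Δ = record
      { φ = λ e → edgeIndex (move e) (leaves e)
      ; ∂φ = [_]
      ; comm-s = λ e → trans (cong ([_] ∘ s G) (edgeOf-edgeIndex (move e) (leaves e)))
                             (trans (cong [_] (move-source e)) ([]-cong (rep-∼ (s G e))))
      ; comm-t = λ e → trans (cong ([_] ∘ t G) (edgeOf-edgeIndex (move e) (leaves e))) ([]-cong (move-target e))
      }

    inj : ∀ I e₁ e₂ → s G e₁ ≡ I → s G e₂ ≡ I → φ Δ e₁ ≡ φ Δ e₂ → e₁ ≡ e₂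
    inj I e₁ e₂ s₁ s₂ eq = move-injective (trans s₁ (sym s₂)) (index-injective leavesRep eq)

    lift : ∀ I i → s quotient i ≡ [ I ] → ∃ λ e → s G e ≡ I × φ Δ e ≡ i
    lift I i s≡ with e , s≡I , move-e≡ ← move-onto I (edgeOf i)
                                          (trans (s-edgeOf i) (trans (cong repOf s≡) (repOf-[] I)))
      = e , s≡I , enum-injective leavesRep (trans (edgeOf-edgeIndex (move e) (leaves e)) move-e≡)

  module _ {H} (Φ : HomR G H) (∼⊆Ker : ∀ {x y} → x ∼ y → Ker Φ x y) where

    private
      module Φ = IsRightResolver (proj₂ Φ)
      F = proj₁ Φ

      ∂Θ-[] : ∀ x → ∂φ F (repOf [ x ]) ≡ ∂φ F x
      ∂Θ-[] x = ∼⊆Ker (subst (_∼ x) (sym (repOf-[] x)) (rep-∼ x))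

    induced : HomR quotient H
    induced = mkHomR Θ onto inj lift
      where
      Θ : Hom quotient H
      Θ = record
        { φ = φ F ∘ edgeOf
        ; ∂φ = ∂φ F ∘ repOf
        ; comm-s = λ i → trans (comm-s F (edgeOf i)) (sym (∂Θ-[] _))
        ; comm-t = λ i → trans (comm-t F (edgeOf i)) (sym (∂Θ-[] _))
        }

      onto : Surjective (∂φ Θ)
      onto h = let x , ∂Φx≡h = Φ.surjV h in [ x ] , trans (∂Θ-[] x) ∂Φx≡h

      inj : ∀ X i₁ i₂ → s quotient i₁ ≡ X → s quotient i₂ ≡ X → φ Θ i₁ ≡ φ Θ i₂ → i₁ ≡ i₂
      inj X i₁ i₂ s₁ s₂ eq = enum-injective leavesRep
        (Φ.localInj (repOf X) (edgeOf i₁) (edgeOf i₂) (trans (s-edgeOf i₁) (cong repOf s₁))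
                                                       (trans (s-edgeOf i₂) (cong repOf s₂)) eq)

      lift : ∀ X e′ → s H e′ ≡ ∂φ Θ X → ∃ λ i → s quotient i ≡ X × φ Θ i ≡ e′
      lift X e′ s≡ with e , s≡X , refl ← Φ.localSurj (repOf X) e′ s≡ =
        edgeIndex e leaves ,
        trans (cong ([_] ∘ s G) (edgeOf-edgeIndex e leaves)) (trans (cong [_] s≡X) ([]-repOf X)) ,
        cong (φ F) (edgeOf-edgeIndex e leaves)
        where
        leaves = leaves-repOf X s≡X

    induced-factorises : (τ : Transport) → (∀ e → φ F (Transport.move τ e) ≡ φ F e) →
                         F ≈H (proj₁ induced ∘H proj₁ (quotientMap τ))
    induced-factorises τ move-preserves-φ =
      (λ e → sym (trans (cong (φ F) (edgeOf-edgeIndex (move e) (move-leavesRep τ e))) (move-preserves-φ e))) ,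
      (λ x → sym (∂Θ-[] x))
      where open Transport τ

    module _ (twins : ∀ {e e′} → s G e ∼ s G e′ → φ F e ≡ φ F e′ → t G e ∼ t G e′) where

      private
        lift : ∀ e → ∃ λ e₀ → s G e₀ ≡ rep (s G e) × φ F e₀ ≡ φ F e
        lift e = Φ.localSurj (rep (s G e)) (φ F e) (trans (comm-s F e) (sym (∼⊆Ker (rep-∼ (s G e)))))

      along : Transport
      along = record
        { move           = proj₁ ∘ lift
        ; move-source    = proj₁ ∘ proj₂ ∘ lift
        ; move-target    = λ e → let _ , s≡ , φ≡ = lift e in
            twins (subst (_∼ s G e) (sym s≡) (rep-∼ (s G e))) φ≡
        ; move-injective = λ {e₁} {e₂} s₁≡s₂ eq → Φ.localInj (s G e₁) e₁ e₂ refl (sym s₁≡s₂)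
            (trans (sym (proj₂ (proj₂ (lift e₁)))) (trans (cong (φ F) eq) (proj₂ (proj₂ (lift e₂)))))
        ; move-onto      = onto
        }
        where
        onto : ∀ I e₀ → s G e₀ ≡ rep I → ∃ λ e → s G e ≡ I × proj₁ (lift e) ≡ e₀
        onto I e₀ s≡ with e , refl , φ≡ ← Φ.localSurj I (φ F e₀)
                            (trans (comm-s F e₀) (trans (cong (∂φ F) s≡) (∼⊆Ker (rep-∼ I))))
          = e , refl , (let e₁ , s₁≡ , φ₁≡ = lift e in Φ.localInj (rep (s G e)) e₁ e₀ s₁≡ s≡ (trans φ₁≡ φ≡))

      along-preserves-φ : ∀ e → φ F (Transport.move along e) ≡ φ F e
      along-preserves-φ = proj₂ ∘ proj₂ ∘ lift

  -- Equal counts give, for each class J, a bijection between the edges from I and from rep I into J.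
  module _ (equitable : Equitable G R) where

    private
      relabel : ∀ I J e → .(T (edgesInto G R I J e)) → E G
      relabel I J = rematch (edgesInto G R I J) (edgesInto G R (rep I) J) (equitable (∼-sym (rep-∼ I)) J)

      relabel-sound : ∀ I J e .(p : T (edgesInto G R I J e)) →
                      s G (relabel I J e p) ≡ rep I × t G (relabel I J e p) ∼ J
      relabel-sound I J e p = toWitness (rematch-sound (edgesInto G R I J) (edgesInto G R (rep I) J) _ e p)

      relabel-cong : ∀ {I I′ J J′ e} .{p p′} → I ≡ I′ → J ≡ J′ → relabel I J e p ≡ relabel I′ J′ e p′
      relabel-cong refl refl = refl

      relabel-injective : ∀ {I I′ J J′ e e′} .{p p′} → I ≡ I′ → J ≡ J′ →
                          relabel I J e p ≡ relabel I′ J′ e′ p′ → e ≡ e′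
      relabel-injective refl refl = rematch-injective _ _ _

      into-rep-target : ∀ e → T (edgesInto G R (s G e) (rep (t G e)) e)
      into-rep-target e = fromWitness (refl , ∼-sym (rep-∼ (t G e)))

      move : E G → E G
      move e = relabel (s G e) (rep (t G e)) e (into-rep-target e)

      move-target : ∀ e → t G (move e) ∼ t G e
      move-target e = ∼-trans (proj₂ (relabel-sound _ _ e (into-rep-target e))) (rep-∼ (t G e))

    byCounts : Transport
    byCounts = record
      { move           = move
      ; move-source    = λ e → proj₁ (relabel-sound _ _ e (into-rep-target e))
      ; move-target    = move-target
      ; move-injective = λ {e₁} {e₂} s₁≡s₂ eq → relabel-injective s₁≡s₂
          (rep-cong (∼-trans (∼-sym (move-target e₁)) (subst (λ e → t G e ∼ t G e₂) (sym eq) (move-target e₂))))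
          eq
      ; move-onto      = onto
      }
      where
      onto : ∀ I e₀ → s G e₀ ≡ rep I → ∃ λ e → s G e ≡ I × move e ≡ e₀
      onto I e₀ s≡ with e , p , relabel≡e₀ ← rematch-onto (edgesInto G R I (rep (t G e₀))) _ _ e₀
                                               (fromWitness (s≡ , ∼-sym (rep-∼ (t G e₀))))
                   with s≡I , t∼J ← toWitness p
        = e , s≡I , trans (relabel-cong s≡I (trans (rep-cong t∼J) (rep-idem _))) relabel≡e₀

module Minimal (G : Graph) where

  refine : BRel (nV G) → BRel (nV G)
  refine R I I′ = ⌊ T? (R I I′) ×-dec all? (λ J → count (edgesInto G R I J) ≟ⁿ count (edgesInto G R I′ J)) ⌋

  refine-⊆ : ∀ R → refine R ⊆ᵇ R
  refine-⊆ R = proj₁ ∘ toWitness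

  refine-equivalence : ∀ {R} → IsEquivalence ⟦ R ⟧ → IsEquivalence ⟦ refine R ⟧
  refine-equivalence R-equiv = record
    { refl  = fromWitness (R.refl , λ _ → refl)
    ; sym   = λ r → let xRy , same = toWitness r in fromWitness (R.sym xRy , sym ∘ same)
    ; trans = λ r₁ r₂ → let xRy , same₁ = toWitness r₁; yRz , same₂ = toWitness r₂ in
                fromWitness (R.trans xRy yRz , λ J → trans (same₁ J) (same₂ J))
    }
    where module R = IsEquivalence R-equiv

  refine-Ker : ∀ {H} (Φ : HomR G H) {R} → IsEquivalence ⟦ R ⟧ →
               Ker Φ ⇒ ⟦ R ⟧ → Ker Φ ⇒ ⟦ refine R ⟧
  refine-Ker Φ R-equiv Ker⊆R x≈y = fromWitness (Ker⊆R x≈y , λ J →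
    ≤-antisym (Ker⇒count-≤ Φ Ker⊆R R.trans x≈y J) (Ker⇒count-≤ Φ Ker⊆R R.trans (sym x≈y) J))
    where module R = IsEquivalence R-equiv

  private
    full : BRel (nV G)
    full _ _ = true

    full-equivalence : IsEquivalence ⟦ full ⟧
    full-equivalence = record { refl = _ ; sym = λ _ → _ ; trans = λ _ _ → _ }

  -- Mrel is the coarsest equitable equivalence; the quotient by it is M(G).
  opaque
    Mrel : BRel (nV G)
    Mrel = proj₁ (deflationary-fixpoint refine refine-⊆ full)

    full↠Mrel : Iterates refine full Mrel
    full↠Mrel = proj₁ (proj₂ (deflationary-fixpoint refine refine-⊆ full))

    refine-Mrel : refine Mrel ≐ Mrel
    refine-Mrel = proj₂ (proj₂ (deflationary-fixpoint refine refine-⊆ full))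

  Mrel-equivalence : IsEquivalence ⟦ Mrel ⟧
  Mrel-equivalence =
    Iterates-preserves refine (λ R → IsEquivalence ⟦ R ⟧) refine-equivalence full↠Mrel full-equivalence

  Mrel-equitable : Equitable G Mrel
  Mrel-equitable {I} {I′} r = proj₂ (toWitness (subst T (sym (refine-Mrel I I′)) r))

  Ker⊆Mrel : ∀ {H} (Φ : HomR G H) → Ker Φ ⇒ ⟦ Mrel ⟧
  Ker⊆Mrel Φ = proj₂ (Iterates-preserves refine Invariant preserved full↠Mrel (full-equivalence , λ _ → _))
    where
    Invariant : BRel (nV G) → Set
    Invariant R = IsEquivalence ⟦ R ⟧ × (Ker Φ ⇒ ⟦ R ⟧)

    preserved : ∀ {R} → Invariant R → Invariant (refine R)
    preserved (R-equiv , Ker⊆R) = refine-equivalence R-equiv , refine-Ker Φ R-equiv Ker⊆R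

  private
    module QM = Quotient G Mrel Mrel-equivalence

  open QM public using () renaming (quotient to M; [_] to [_]ᴹ; []-cong to []ᴹ-cong)

  ΔM : HomR G M
  ΔM = QM.quotientMap (QM.byCounts Mrel-equitable)

  resolves-to-M : ∀ {H} (Φ : HomR G H) → Σ (HomR H M) λ χ → ∀ x → ∂φ (proj₁ χ) (∂φ (proj₁ Φ) x) ≡ [ x ]ᴹ
  resolves-to-M Φ = descend Φ ΔM ([]ᴹ-cong ∘ Ker⊆Mrel Φ)

  M-minimal : IsMinimalBelow M G
  M-minimal = ΔM , λ K K≤G K≤M → HomR-antisym (proj₁ (resolves-to-M K≤G)) K≤M

module BunchyQuotient (G : Graph) where

  open Minimal G

  data Step (R : BRel (nV G)) (J J′ : V G) : Set where
    keep   : T (R J J′) → Step R J J′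
    swap   : T (R J′ J) → Step R J J′
    chain  : ∀ K → T (R J K) → T (R K J′) → Step R J J′
    follow : ∀ I I′ → T (R I I′) → inF G I J → inF G I′ J′ → T (Mrel J J′) → Step R J J′

  step? : ∀ R J J′ → Dec (Step R J J′)
  step? R J J′ = map′ to from
    (T? (R J J′) ⊎-dec T? (R J′ J) ⊎-dec any? (λ K → T? (R J K) ×-dec T? (R K J′)) ⊎-dec
     any? (λ I → any? λ I′ → T? (R I I′) ×-dec inF? G I J ×-dec inF? G I′ J′ ×-dec T? (Mrel J J′)))
    where
    to : _ → Step R J J′
    to (inj₁ r)                                            = keep r
    to (inj₂ (inj₁ r))                                     = swap r
    to (inj₂ (inj₂ (inj₁ (K , r₁ , r₂))))                  = chain K r₁ r₂
    to (inj₂ (inj₂ (inj₂ (I , I′ , r , f , f′ , m))))      = follow I I′ r f f′ m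

    from : Step R J J′ → _
    from (keep r)                = inj₁ r
    from (swap r)                = inj₂ (inj₁ r)
    from (chain K r₁ r₂)         = inj₂ (inj₂ (inj₁ (K , r₁ , r₂)))
    from (follow I I′ r f f′ m)  = inj₂ (inj₂ (inj₂ (I , I′ , r , f , f′ , m)))

  close : BRel (nV G) → BRel (nV G)
  close R J J′ = ⌊ step? R J J′ ⌋

  close-⊇ : ∀ R → R ⊆ᵇ close R
  close-⊇ R = fromWitness ∘ keep

  private
    identity : BRel (nV G)
    identity x y = ⌊ x ≟ᶠ y ⌋

  -- Brel is the least equivalence identifying J and J′ whenever they are Mrel-related and follow
  -- states it already identifies.
  opaque
    Brel : BRel (nV G)
    Brel = proj₁ (inflationary-fixpoint close close-⊇ identity)

    identity↠Brel : Iterates close identity Brel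
    identity↠Brel = proj₁ (proj₂ (inflationary-fixpoint close close-⊇ identity))

    close-Brel : close Brel ≐ Brel
    close-Brel = proj₂ (proj₂ (inflationary-fixpoint close close-⊇ identity))

  Brel-closed : ∀ {J J′} → Step Brel J J′ → T (Brel J J′)
  Brel-closed {J} {J′} st = subst T (close-Brel J J′) (fromWitness st)

  Brel-least : ∀ {S : Rel (V G) 0ℓ} → IsEquivalence S →
               (∀ {I I′ J J′} → S I I′ → inF G I J → inF G I′ J′ → T (Mrel J J′) → S J J′) →
               ⟦ Brel ⟧ ⇒ S
  Brel-least {S} S-equiv S-follow = Iterates-preserves close (λ R → ⟦ R ⟧ ⇒ S)
    (λ R⊆S → step⊆S R⊆S ∘ toWitness) identity↠Brel (λ x≡y → S.reflexive (toWitness x≡y))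
    where
    module S = IsEquivalence S-equiv

    step⊆S : ∀ {R} → ⟦ R ⟧ ⇒ S → Step R ⇒ S
    step⊆S R⊆S (keep r)               = R⊆S r
    step⊆S R⊆S (swap r)               = S.sym (R⊆S r)
    step⊆S R⊆S (chain _ r₁ r₂)        = S.trans (R⊆S r₁) (R⊆S r₂)
    step⊆S R⊆S (follow _ _ r f f′ m)  = S-follow (R⊆S r) f f′ m

  Brel-equivalence : IsEquivalence ⟦ Brel ⟧
  Brel-equivalence = record
    { refl  = λ {x} → Iterates-preserves close (λ R → T (R x x)) (close-⊇ _) identity↠Brel (fromWitness refl)
    ; sym   = Brel-closed ∘ swap
    ; trans = λ r₁ r₂ → Brel-closed (chain _ r₁ r₂)
    }

  Brel⊆Mrel : Brel ⊆ᵇ Mrel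
  Brel⊆Mrel = Brel-least Mrel-equivalence (λ _ _ _ m → m)

  Brel-twins : ∀ {H} (Φ : HomR G H) {e e′} → T (Brel (s G e) (s G e′)) → φ (proj₁ Φ) e ≡ φ (proj₁ Φ) e′ →
               T (Brel (t G e) (t G e′))
  Brel-twins {H} (Φ , Φ-rr) {e} {e′} r φ≡ = Brel-closed (follow _ _ r (e , refl , refl) (e′ , refl , refl)
    (Ker⊆Mrel (Φ , Φ-rr) (trans (sym (comm-t Φ e)) (trans (cong (t H) φ≡) (comm-t Φ e′)))))

  private
    module QB = Quotient G Brel Brel-equivalence

  B : Graph
  B = QB.quotient

  factorisation : ∀ {H} (Φ : HomR G H) → (⟦ Brel ⟧ ⇒ Ker Φ) →
                  Σ (HomR G B) λ Δ → Σ (HomR B H) λ Θ → proj₁ Φ ≈H (proj₁ Θ ∘H proj₁ Δ)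
  factorisation Φ Brel⊆Ker =
    QB.quotientMap τ , QB.induced Φ Brel⊆Ker ,
    QB.induced-factorises Φ Brel⊆Ker τ (QB.along-preserves-φ Φ Brel⊆Ker (Brel-twins Φ))
    where
    τ = QB.along Φ Brel⊆Ker (Brel-twins Φ)

  ΔB : HomR G B
  ΔB = proj₁ (factorisation ΔM ([]ᴹ-cong ∘ Brel⊆Mrel))

  B-bunchy : Bunchy B
  B-bunchy X = bunchy-if-followers-separated X (separated X)
    where
    -- Two followers of X are targets of G-edges with Brel-related sources, and Ψ ∘ ΔB identifies them.
    separated : ∀ X {M′} (Ψ : HomR B M′) {J₁ J₂} → inF B X J₁ → inF B X J₂ →
                ∂φ (proj₁ Ψ) J₁ ≡ ∂φ (proj₁ Ψ) J₂ → J₁ ≡ J₂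
    separated _ Ψ (i₁ , refl , refl) (i₂ , s₂≡ , refl) Ψ≡ =
      QB.[]-cong (Brel-closed (follow _ _ (QB.[]≡⇒∼ (sym s₂≡))
        (QB.edgeOf i₁ , refl , refl) (QB.edgeOf i₂ , refl , refl) (Ker⊆Mrel (Ψ ∘R ΔB) Ψ≡)))

  Brel⊆Ker-of-bunchy : ∀ {H} (Φ : HomR G H) → Bunchy H → ⟦ Brel ⟧ ⇒ Ker Φ
  Brel⊆Ker-of-bunchy {H} Φ H-bunchy = Brel-least (record { refl = refl ; sym = sym ; trans = trans }) Ker-follow
    where
    F = proj₁ Φ
    χ = proj₁ (resolves-to-M Φ)
    χ∘Φ = proj₂ (resolves-to-M Φ)

    M-minimal-below-H : IsMinimalBelow M H
    M-minimal-below-H = χ , λ K K≤H K≤M → proj₂ M-minimal K (K≤H ∘R Φ) K≤M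

    -- Bunchiness of H at ∂Φ I separates the images of J and J′, which have the same image in M.
    Ker-follow : ∀ {I I′ J J′} → Ker Φ I I′ → inF G I J → inF G I′ J′ → T (Mrel J J′) → Ker Φ J J′
    Ker-follow {I} {I′} {J} {J′} I≈I′ f f′ m = proj₁ (proj₂ (H-bunchy (∂φ F I) M M-minimal-below-H χ)) _ _
      (inF-map F f) (subst (λ h → inF H h (∂φ F J′)) (sym I≈I′) (inF-map F f′))
      (trans (χ∘Φ J) (trans ([]ᴹ-cong m) (sym (χ∘Φ J′))))

proposition5p19 : ∀ (G : Graph) → Σ Graph λ B →
    IsMaximalBunchy G B
  × (∀ (B' : Graph) → IsMaximalBunchy G B' → B' ≅ B)
  × (∀ (H : Graph) → H ≤R G → Bunchy H → (Φ : HomR G H) →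
       Σ (HomR G B) λ Δ → Σ (HomR B H) λ Θ →
         proj₁ Φ ≈H (proj₁ Θ ∘H proj₁ Δ))
proposition5p19 G = B , (B-in-set , B-maximal) , B-unique , factorise
  where
  open BunchyQuotient G

  factorise : ∀ H → H ≤R G → Bunchy H → (Φ : HomR G H) →
              Σ (HomR G B) λ Δ → Σ (HomR B H) λ Θ → proj₁ Φ ≈H (proj₁ Θ ∘H proj₁ Δ)
  factorise H _ H-bunchy Φ = factorisation Φ (Brel⊆Ker-of-bunchy Φ H-bunchy)

  below-B : ∀ {H} → InBunchySet G H → H ≤R B
  below-B {H} (H≤G , H-bunchy) = proj₁ (proj₂ (factorise H H≤G H-bunchy H≤G))

  B-in-set : InBunchySet G B
  B-in-set = ΔB , B-bunchy

  B-maximal : ∀ H → InBunchySet G H → B ≤R H → H ≅ B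
  B-maximal H H-in B≤H = HomR-antisym B≤H (below-B H-in)

  B-unique : ∀ B′ → IsMaximalBunchy G B′ → B′ ≅ B
  B-unique B′ (B′-in , B′-maximal) = ≅-sym (B′-maximal B B-in-set (below-B B′-in))
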